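{- Let $G$ be a finite group and let $H$ be a Sylow $2$-subgroup of $G$. Then $H$ is a perfect code of $G$.
   Context: All groups and graphs are finite; graphs are undirected and simple. $e$ denotes the identity element. For a group $G$ and an inverse-closed subset $S\subseteq G\setminus\{e\}$, the Cayley graph $\mathrm{Cay}(G,S)$ has vertex set $G$, with $x,y$ adjacent iff $yx^{ -1}\in S$. A subset $C$ of the vertex set of a graph $\Gamma$ is a perfect code in $\Gamma$ if every vertex of $\Gamma$ is at distance at most $1$ from exactly one vertex of $C$. A subset $C$ of a group $G$ is a perfect code of $G$ if $C$ is a perfect code in some Cayley graph of $G$. -}

module Defs where

open import Data.Nat using (ℕ; suc; _^_; _+_)
open import Data.Nat.Divisibility using (_∣_)
open import Data.Fin using (Fin)
open import Data.Fin.Subset using (Subset; _∈_; _∉_; ∣_∣)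
open import Data.Product using (Σ; ∃; _×_; _,_)
open import Data.Sum using (_⊎_)
open import Relation.Nullary using (¬_)
open import Relation.Binary.PropositionalEquality using (_≡_)
open import Algebra.Structures using (IsGroup)

record FinGroup : Set where
  field
    order   : ℕ
    _∙_     : Fin order → Fin order → Fin order
    e       : Fin order
    _⁻¹     : Fin order → Fin order
    isGroup : IsGroup _≡_ _∙_ e _⁻¹

module _ (G : FinGroup) where
  open FinGroup G

  IsSubgroup : Subset order → Set
  IsSubgroup H = (e ∈ H)
               × (∀ x y → x ∈ H → y ∈ H → (x ∙ y) ∈ H)
               × (∀ x → x ∈ H → (x ⁻¹) ∈ H)

  IsSylow : ℕ → Subset order → Set
  IsSylow p H = IsSubgroup H
              × Σ ℕ (λ a → (∣ H ∣ ≡ p ^ a) × (p ^ a ∣ order) × ¬ (p ^ (suc a) ∣ order))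

  IsConnectionSet : Subset order → Set
  IsConnectionSet S = (e ∉ S) × (∀ x → x ∈ S → (x ⁻¹) ∈ S)

  Adj : Subset order → Fin order → Fin order → Set
  Adj S x y = (y ∙ (x ⁻¹)) ∈ S

  Dist≤1 : Subset order → Fin order → Fin order → Set
  Dist≤1 S x y = (x ≡ y) ⊎ Adj S x y

  IsPerfectCodeIn : Subset order → Subset order → Set
  IsPerfectCodeIn S C = ∀ x → Σ (Fin order) (λ c → (c ∈ C) × Dist≤1 S x c
                                × (∀ c' → c' ∈ C → Dist≤1 S x c' → c' ≡ c))

  IsPerfectCodeOf : Subset order → Set
  IsPerfectCodeOf C = Σ (Subset order) (λ S → IsConnectionSet S × IsPerfectCodeIn S C)

module Submission where

-- Call T ⊆ G a symmetric transversal if e ∈ T, T = T⁻¹, e is the only involution in T and T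
-- meets every right coset of H at most once. Once T meets every right coset, H is a perfect code
-- in Cay(G, T ∖ {e}). Starting from {e}, an uncovered coset H a is covered by adjoining t, t⁻¹
-- for some t ∈ H a whose inverse lies in a second uncovered coset. Such t exists unless H a is
-- the only uncovered coset in H a⁻¹ H. Counting cosets then shows that H a H = H a⁻¹ H is the
-- union of an odd number of right cosets (the covered ones pair up under inversion, H a is the
-- only uncovered one), and y = a⁻¹ h has y² ∈ H for some h ∈ H. For a Sylow 2-subgroup H that
-- odd number |H : H ∩ y⁻¹ H y| divides |H| = 2^α, so y normalises H, and H ∪ H y would be a
-- subgroup of order 2^(α+1) unless y ∈ H. Hence a ∈ H, which is covered by e.

open import Level using (0ℓ)
open import Function using (_∘_)
open import Data.Empty using (⊥-elim)
open import Data.Unit using (tt)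
open import Data.Bool using (Bool; true; false; not)
import Data.Bool.Properties as Bool
open import Data.Product using (Σ-syntax; _×_; _,_; proj₁; proj₂)
import Data.Product.Properties as Product
open import Data.Sum using (_⊎_; inj₁; inj₂)
open import Data.Nat using (ℕ; zero; suc; _+_; _*_; _^_; _≤_; _<_; s≤s; z≤n; s≤s⁻¹; >-nonZero)
open import Data.Nat.Properties
  using (+-*-semiring; *-commutativeSemigroup; *-identityʳ; +-identityʳ; *-comm; *-assoc; +-comm;
         *-cancelˡ-≡; m*n≡1⇒m≡1; <-irrefl; ≤-refl; <-≤-trans; m<m+n)
open import Data.Nat.Divisibility using (_∣_; divides; ∣m+n∣m⇒∣n; ∣1⇒≡1)
open import Data.Nat.Primality using (prime?; euclidsLemma)
open import Data.Fin using (Fin; zero; suc) renaming (_<_ to _<ᶠ_)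
open import Data.Fin.Properties using (_≟_; suc-injective; any?)
import Data.Fin.Properties as Fin
open import Data.Fin.Subset using (Subset; ∣_∣; _∈_; _∉_; ⁅_⁆; _─_; _-_; inside; outside)
  renaming (_∪_ to _∪ˢ_; ⊥ to ∅ˢ)
open import Data.Fin.Subset.Properties
  using (_∈?_; drop-there; ∉⊥; x∈p∪q⁻; x∈p∪q⁺; x∈⁅x⁆; x∈⁅y⁆⇒x≡y; x∉⁅y⁆⇒x≢y; p─q⊆p;
         x∈p∧x≢y⇒x∈p-y)
open import Data.List using (List; []; _∷_; foldr)
open import Data.Vec using (Vec; []; _∷_; lookup; here; there)
open import Relation.Nullary using (Dec; yes; no; ¬_; contradiction)
open import Relation.Nullary.Decidable using (_⊎-dec_; _×-dec_; decidable-stable; from-yes)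
open import Relation.Unary using (Pred; Decidable; _⊆_; _∩_; _∪_)
open import Relation.Unary.Properties using (_∩?_; _∪?_; ∁?; U?)
open import Relation.Binary using (tri<; tri≈; tri>)
open import Relation.Binary.PropositionalEquality
open import Algebra.Bundles using (Group)
open import Algebra.Structures using (IsGroup)
open import Algebra.Properties.Semiring.Sum +-*-semiring
  using (sum; sum-cong-≗; sum-replicate-zero; ∑-distrib-+; ∑-comm; *-distribˡ-sum; *-distribʳ-sum)
open import Algebra.Properties.CommutativeSemigroup *-commutativeSemigroup using (x∙yz≈y∙xz)

open import Defs

private variable
  m : ℕ
  P Q : Pred (Fin m) 0ℓ

2∣n⇒2∤1+n : ∀ {k} → 2 ∣ k → ¬ 2 ∣ suc k
2∣n⇒2∤1+n {k} 2∣k 2∣1+k =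
  contradiction (∣1⇒≡1 (∣m+n∣m⇒∣n (subst (2 ∣_) (+-comm 1 k) 2∣1+k) 2∣k)) λ ()

odd-factor-of-2^ : ∀ α {k l} → k * l ≡ 2 ^ α → ¬ 2 ∣ k → k ≡ 1
odd-factor-of-2^ zero    {k} {l} kl≡1 _ = m*n≡1⇒m≡1 k l kl≡1
odd-factor-of-2^ (suc α) {k} {l} kl≡2^1+α 2∤k
  with euclidsLemma k l (from-yes (prime? 2)) (divides (2 ^ α) (trans kl≡2^1+α (*-comm 2 (2 ^ α))))
... | inj₁ 2∣k = contradiction 2∣k 2∤k
... | inj₂ (divides q refl) = odd-factor-of-2^ α (*-cancelˡ-≡ (k * q) (2 ^ α) 2 (begin
  2 * (k * q)   ≡⟨ x∙yz≈y∙xz 2 k q ⟩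
  k * (2 * q)   ≡⟨ cong (k *_) (*-comm 2 q) ⟩
  k * (q * 2)   ≡⟨ kl≡2^1+α ⟩
  2 * 2 ^ α     ∎)) 2∤k
  where open ≡-Reasoning

indicator : ∀ {p} {X : Set p} → Dec X → ℕ
indicator (yes _) = 1
indicator (no _)  = 0

count : Decidable P → ℕ
count P? = sum (λ x → indicator (P? x))

indicator-∩ : (P? : Decidable P) (Q? : Decidable Q) (x : Fin m) →
              indicator ((P? ∩? Q?) x) ≡ indicator (P? x) * indicator (Q? x)
indicator-∩ P? Q? x with P? x | Q? x
... | yes _ | yes _ = refl
... | yes _ | no _  = refl
... | no _  | _     = refl

count-cong : (P? : Decidable P) (Q? : Decidable Q) → P ⊆ Q → Q ⊆ P → count P? ≡ count Q?
count-cong P? Q? P⊆Q Q⊆P = sum-cong-≗ pointwise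
  where
  pointwise : ∀ x → indicator (P? x) ≡ indicator (Q? x)
  pointwise x with P? x | Q? x
  ... | yes _ | yes _  = refl
  ... | yes p | no ¬q  = contradiction (P⊆Q p) ¬q
  ... | no ¬p | yes q  = contradiction (Q⊆P q) ¬p
  ... | no _  | no _   = refl

count-U : ∀ m → count (U? {A = Fin m}) ≡ m
count-U zero    = refl
count-U (suc m) = cong suc (count-U m)

count-∅ : {P : Pred (Fin m) 0ℓ} (P? : Decidable P) → (∀ x → ¬ P x) → count P? ≡ 0
count-∅ {m} P? ¬P = trans (sum-cong-≗ pointwise) (sum-replicate-zero m)
  where
  pointwise : ∀ x → indicator (P? x) ≡ 0
  pointwise x with P? x
  ... | yes p = contradiction p (¬P x)
  ... | no _  = refl

count-≟ : (x : Fin m) → count (_≟ x) ≡ 1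
count-≟ {suc m} zero = cong suc (count-∅ {m} (λ y → suc y ≟ zero) (λ _ ()))
count-≟ {suc m} (suc x) =
  trans (count-cong (λ y → suc y ≟ suc x) (_≟ x) suc-injective (cong suc)) (count-≟ x)

count-unique : (P? : Decidable P) {x : Fin m} → P x → (∀ {y} → P y → y ≡ x) → count P? ≡ 1
count-unique P? {x} px unique =
  trans (count-cong P? (_≟ x) unique (λ y≡x → subst _ (sym y≡x) px)) (count-≟ x)

sum-indicator-* : (P? : Decidable P) (f : Fin m → ℕ) {r : ℕ} → (∀ {x} → P x → f x ≡ r) →
                  sum (λ x → indicator (P? x) * f x) ≡ count P? * r
sum-indicator-* P? f {r} f≡r = begin
  sum (λ x → indicator (P? x) * f x) ≡⟨ sum-cong-≗ pointwise ⟩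
  sum (λ x → indicator (P? x) * r)   ≡⟨ *-distribʳ-sum r (λ x → indicator (P? x)) ⟨
  count P? * r                       ∎
  where
  open ≡-Reasoning
  pointwise : ∀ x → indicator (P? x) * f x ≡ indicator (P? x) * r
  pointwise x with P? x
  ... | yes p = cong (_+ 0) (f≡r p)
  ... | no _  = refl

module _ {A B : Pred (Fin m) 0ℓ} {R : Fin m → Pred (Fin m) 0ℓ} (A? : Decidable A) (B? : Decidable B)
         (R? : ∀ x → Decidable (R x)) where

  count-double : {r s : ℕ} →
                 (∀ {x} → A x → count (B? ∩? R? x) ≡ r) →
                 (∀ {y} → B y → count (A? ∩? (λ x → R? x y)) ≡ s) →
                 count A? * r ≡ count B? * s
  count-double {r} {s} fibreA fibreB = begin
    count A? * r
      ≡⟨ sum-indicator-* A? (λ x → count (B? ∩? R? x)) fibreA ⟨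
    sum (λ x → [A] x * sum (λ y → [B∩R] x y))
      ≡⟨ sum-cong-≗ (λ x → *-distribˡ-sum ([A] x) ([B∩R] x)) ⟩
    sum (λ x → sum (λ y → [A] x * [B∩R] x y))
      ≡⟨ sum-cong-≗ (λ x → sum-cong-≗ (λ y → swap x y)) ⟩
    sum (λ x → sum (λ y → [B] y * [A∩R] x y))
      ≡⟨ ∑-comm (λ x y → [B] y * [A∩R] x y) ⟩
    sum (λ y → sum (λ x → [B] y * [A∩R] x y))
      ≡⟨ sum-cong-≗ (λ y → *-distribˡ-sum ([B] y) (λ x → [A∩R] x y)) ⟨
    sum (λ y → [B] y * sum (λ x → [A∩R] x y))
      ≡⟨ sum-indicator-* B? (λ y → count (A? ∩? (λ x → R? x y))) fibreB ⟩
    count B? * s ∎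
    where
    open ≡-Reasoning
    [A] [B] : Fin m → ℕ
    [A] x = indicator (A? x)
    [B] y = indicator (B? y)
    [B∩R] [A∩R] : Fin m → Fin m → ℕ
    [B∩R] x y = indicator ((B? ∩? R? x) y)
    [A∩R] x y = indicator ((A? ∩? (λ x → R? x y)) x)
    swap : ∀ x y → [A] x * [B∩R] x y ≡ [B] y * [A∩R] x y
    swap x y = begin
      [A] x * [B∩R] x y                        ≡⟨ cong ([A] x *_) (indicator-∩ B? (R? x) y) ⟩
      [A] x * ([B] y * indicator (R? x y))     ≡⟨ x∙yz≈y∙xz ([A] x) ([B] y) _ ⟩
      [B] y * ([A] x * indicator (R? x y))     ≡⟨ cong ([B] y *_) (indicator-∩ A? (λ x → R? x y) x) ⟨
      [B] y * [A∩R] x y                        ∎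

count-bijection : {A B : Pred (Fin m) 0ℓ} (A? : Decidable A) (B? : Decidable B) (f g : Fin m → Fin m) →
                  (∀ {x} → A x → B (f x)) → (∀ {y} → B y → A (g y)) →
                  (∀ x → g (f x) ≡ x) → (∀ y → f (g y) ≡ y) → count A? ≡ count B?
count-bijection {A = A} {B} A? B? f g f-maps g-maps g∘f f∘g = begin
  count A?     ≡⟨ *-identityʳ _ ⟨
  count A? * 1 ≡⟨ count-double A? B? (λ x y → y ≟ f x) imageOf preimageOf ⟩
  count B? * 1 ≡⟨ *-identityʳ _ ⟩
  count B?     ∎
  where
  open ≡-Reasoning
  imageOf : ∀ {x} → A x → count (B? ∩? (λ y → y ≟ f x)) ≡ 1
  imageOf {x} ax = count-unique (B? ∩? (λ y → y ≟ f x)) (f-maps ax , refl) proj₂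
  preimageOf : ∀ {y} → B y → count (A? ∩? (λ x → y ≟ f x)) ≡ 1
  preimageOf {y} by = count-unique (A? ∩? (λ x → y ≟ f x)) (g-maps by , sym (f∘g y))
                                   λ { {x} (_ , refl) → sym (g∘f x) }

count-split : (P? : Decidable P) (Q? : Decidable Q) →
              count P? ≡ count (P? ∩? Q?) + count (P? ∩? ∁? Q?)
count-split P? Q? = trans (sum-cong-≗ pointwise)
  (∑-distrib-+ (λ x → indicator ((P? ∩? Q?) x)) (λ x → indicator ((P? ∩? ∁? Q?) x)))
  where
  pointwise : ∀ x → indicator (P? x) ≡ indicator ((P? ∩? Q?) x) + indicator ((P? ∩? ∁? Q?) x)
  pointwise x with P? x | Q? x
  ... | yes _ | yes _ = refl
  ... | yes _ | no _  = refl
  ... | no _  | _     = refl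

count-∪-disjoint : (P? : Decidable P) (Q? : Decidable Q) → (∀ {x} → P x → ¬ Q x) →
                   count (P? ∪? Q?) ≡ count P? + count Q?
count-∪-disjoint {P = P} {Q = Q} P? Q? disjoint = trans (count-split (P? ∪? Q?) P?)
  (cong₂ _+_ (count-cong ((P? ∪? Q?) ∩? P?) P? proj₂ (λ p → inj₁ p , p))
             (count-cong ((P? ∪? Q?) ∩? ∁? P?) Q? only-Q (λ q → inj₂ q , λ p → disjoint p q)))
  where
  only-Q : ∀ {x} → (P ∪ Q) x × ¬ P x → Q x
  only-Q (inj₁ p , ¬p) = contradiction p ¬p
  only-Q (inj₂ q , _)  = q

count-pos : (P? : Decidable P) {x : Fin m} → P x → 0 < count P?
count-pos P? {x} px = subst (0 <_) (sym (count-split P? (_≟ x)))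
  (subst (λ k → 0 < k + count (P? ∩? ∁? (_≟ x)))
         (sym (count-unique (P? ∩? (_≟ x)) (px , refl) proj₂)) (s≤s z≤n))

count-< : (P? : Decidable P) (Q? : Decidable Q) {x : Fin m} →
          P ⊆ Q → Q x → ¬ P x → count P? < count Q?
count-< P? Q? P⊆Q qx ¬px = subst (count P? <_) (sym (begin
  count Q?                                   ≡⟨ count-split Q? P? ⟩
  count (Q? ∩? P?) + count (Q? ∩? ∁? P?)     ≡⟨ cong (_+ count (Q? ∩? ∁? P?)) Q∩P≡P ⟩
  count P? + count (Q? ∩? ∁? P?)             ∎))
  (m<m+n (count P?) (count-pos (Q? ∩? ∁? P?) (qx , ¬px)))
  where
  open ≡-Reasoning
  Q∩P≡P : count (Q? ∩? P?) ≡ count P?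
  Q∩P≡P = count-cong (Q? ∩? P?) P? proj₂ λ p → P⊆Q p , p

count-≡⇒⊇ : (P? : Decidable P) (Q? : Decidable Q) → P ⊆ Q → count P? ≡ count Q? → Q ⊆ P
count-≡⇒⊇ P? Q? P⊆Q eq {x} qx with P? x
... | yes px = px
... | no ¬px = contradiction eq (λ eq → <-irrefl eq (count-< P? Q? P⊆Q qx ¬px))

∣p∣≡count : (p : Subset m) → ∣ p ∣ ≡ count (_∈? p)
∣p∣≡count []          = refl
∣p∣≡count (true ∷ p)  =
  cong suc (trans (∣p∣≡count p) (count-cong (_∈? p) (λ x → suc x ∈? true ∷ p) there drop-there))
∣p∣≡count (false ∷ p) =
  trans (∣p∣≡count p) (count-cong (_∈? p) (λ x → suc x ∈? false ∷ p) there drop-there)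

count-even : {P : Pred (Fin m) 0ℓ} (P? : Decidable P) (σ : Fin m → Fin m) →
             (∀ x → σ (σ x) ≡ x) → (∀ {x} → P x → P (σ x)) → (∀ {x} → P x → σ x ≢ x) →
             2 ∣ count P?
count-even {m} {P} P? σ σ∘σ P-σ σ-fixless =
  divides (count Lower?) (trans (sym (*-identityʳ (count P?))) (sym pairs))
  where
  -- Each orbit {t, σ t} has exactly one element below its partner.
  Lower : Pred (Fin m) 0ℓ
  Lower = P ∩ (λ q → q <ᶠ σ q)
  Lower? : Decidable Lower
  Lower? = P? ∩? (λ q → q Fin.<? σ q)
  Orbit : Fin m → Pred (Fin m) 0ℓ
  Orbit q t = t ≡ q ⊎ t ≡ σ q
  Orbit? : ∀ q → Decidable (Orbit q)
  Orbit? q t = (t ≟ q) ⊎-dec (t ≟ σ q)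
  orbit-of-lower : ∀ {q} → Lower q → count (P? ∩? Orbit? q) ≡ 2
  orbit-of-lower {q} (pq , _) = begin
    count (P? ∩? Orbit? q)
      ≡⟨ count-split (P? ∩? Orbit? q) (_≟ q) ⟩
    count ((P? ∩? Orbit? q) ∩? (_≟ q)) + count ((P? ∩? Orbit? q) ∩? ∁? (_≟ q))
      ≡⟨ cong₂ _+_ (count-unique ((P? ∩? Orbit? q) ∩? (_≟ q)) ((pq , inj₁ refl) , refl) proj₂)
                   (count-unique ((P? ∩? Orbit? q) ∩? ∁? (_≟ q))
                                 ((P-σ pq , inj₂ refl) , σ-fixless pq) σq-only) ⟩
    2 ∎
    where
    open ≡-Reasoning
    σq-only : ∀ {t} → (P t × Orbit q t) × t ≢ q → t ≡ σ q
    σq-only ((_ , inj₁ t≡q) , t≢q) = contradiction t≡q t≢q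
    σq-only ((_ , inj₂ t≡σq) , _)  = t≡σq
  lower-of-orbit : ∀ {t} → P t → count (Lower? ∩? (λ q → Orbit? q t)) ≡ 1
  lower-of-orbit {t} pt with Fin.<-cmp t (σ t)
  ... | tri< t<σt _ _ = count-unique (Lower? ∩? (λ q → Orbit? q t)) ((pt , t<σt) , inj₁ refl) only-t
    where
    only-t : ∀ {q} → Lower q × Orbit q t → q ≡ t
    only-t (_ , inj₁ t≡q) = sym t≡q
    only-t {q} ((_ , q<σq) , inj₂ t≡σq) =
      ⊥-elim (Fin.<-asym t<σt (subst₂ _<ᶠ_ (trans (sym (σ∘σ q)) (cong σ (sym t≡σq))) (sym t≡σq) q<σq))
  ... | tri≈ _ t≡σt _ = contradiction (sym t≡σt) (σ-fixless pt)
  ... | tri> _ _ σt<t = count-unique (Lower? ∩? (λ q → Orbit? q t))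
    ((P-σ pt , subst (σ t <ᶠ_) (sym (σ∘σ t)) σt<t) , inj₂ (sym (σ∘σ t))) only-σt
    where
    only-σt : ∀ {q} → Lower q × Orbit q t → q ≡ σ t
    only-σt ((_ , q<σq) , inj₁ refl) = ⊥-elim (Fin.<-asym σt<t q<σq)
    only-σt {q} (_ , inj₂ refl) = sym (σ∘σ q)
  pairs : count Lower? * 2 ≡ count P? * 1
  pairs = count-double Lower? P? Orbit? orbit-of-lower lower-of-orbit

x∈p─q⇒x∉q : ∀ {x : Fin m} (p q : Subset m) → x ∈ p ─ q → x ∉ q
x∈p─q⇒x∉q (s ∷ p)      (t ∷ q)       (there x∈p─q) = x∈p─q⇒x∉q p q x∈p─q ∘ drop-there
x∈p─q⇒x∉q (inside ∷ p) (outside ∷ q) here          = λ ()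

x∈p-y⇒x≢y : ∀ {x y : Fin m} (p : Subset m) → x ∈ p - y → x ≢ y
x∈p-y⇒x≢y {y = y} p x∈p-y = x∉⁅y⁆⇒x≢y (x∈p─q⇒x∉q p ⁅ y ⁆ x∈p-y)

module GroupSolver {A : Set} {_∙_ : A → A → A} {ε : A} {_⁻¹ : A → A}
                   (isGroup : IsGroup _≡_ _∙_ ε _⁻¹) where

  open IsGroup isGroup using (assoc; identityˡ; identityʳ; inverseˡ)

  group : Group 0ℓ 0ℓ
  group = record { isGroup = isGroup }

  open import Algebra.Properties.Group group using (ε⁻¹≈ε; ⁻¹-involutive; ⁻¹-anti-homo-∙)

  infixl 7 _⊗_
  infix  8 _⁻

  data Expr (k : ℕ) : Set where
    var  : Fin k → Expr k
    unit : Expr k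
    _⊗_  : Expr k → Expr k → Expr k
    _⁻   : Expr k → Expr k

  ⟦_⟧ : ∀ {k} → Expr k → Vec A k → A
  ⟦ var i ⟧ ρ = lookup ρ i
  ⟦ unit  ⟧ ρ = ε
  ⟦ x ⊗ y ⟧ ρ = ⟦ x ⟧ ρ ∙ ⟦ y ⟧ ρ
  ⟦ x ⁻   ⟧ ρ = ⟦ x ⟧ ρ ⁻¹

  -- A letter (i , false) stands for the inverse of the i-th variable.
  Letter : ℕ → Set
  Letter k = Fin k × Bool

  Word : ℕ → Set
  Word k = List (Letter k)

  flip : ∀ {k} → Letter k → Letter k
  flip (i , b) = i , not b

  push : ∀ {k} → Letter k → Word k → Word k
  push l []      = l ∷ []
  push l (m ∷ w) with Product.≡-dec _≟_ Bool._≟_ l (flip m)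
  ... | yes _ = w
  ... | no _  = l ∷ m ∷ w

  _·ʷ_ : ∀ {k} → Word k → Word k → Word k
  u ·ʷ w = foldr push w u

  invʷ : ∀ {k} → Word k → Word k
  invʷ = foldr (λ l w → w ·ʷ (flip l ∷ [])) []

  normalise : ∀ {k} → Expr k → Word k
  normalise (var i) = (i , true) ∷ []
  normalise unit    = []
  normalise (x ⊗ y) = normalise x ·ʷ normalise y
  normalise (x ⁻)   = invʷ (normalise x)

  module _ {k : ℕ} (ρ : Vec A k) where

    ⟦_⟧ˡ : Letter k → A
    ⟦ i , true  ⟧ˡ = lookup ρ i
    ⟦ i , false ⟧ˡ = lookup ρ i ⁻¹

    ⟦_⟧ʷ : Word k → A
    ⟦ []    ⟧ʷ = ε
    ⟦ l ∷ w ⟧ʷ = ⟦ l ⟧ˡ ∙ ⟦ w ⟧ʷ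

    flip-sound : ∀ l → ⟦ flip l ⟧ˡ ≡ ⟦ l ⟧ˡ ⁻¹
    flip-sound (i , true)  = refl
    flip-sound (i , false) = sym (⁻¹-involutive _)

    flip-cancel : ∀ m → ⟦ flip m ⟧ˡ ∙ ⟦ m ⟧ˡ ≡ ε
    flip-cancel m = trans (cong (_∙ ⟦ m ⟧ˡ) (flip-sound m)) (inverseˡ _)

    push-sound : ∀ l w → ⟦ push l w ⟧ʷ ≡ ⟦ l ⟧ˡ ∙ ⟦ w ⟧ʷ
    push-sound l []      = refl
    push-sound l (m ∷ w) with Product.≡-dec _≟_ Bool._≟_ l (flip m)
    ... | yes refl = sym (begin
      ⟦ flip m ⟧ˡ ∙ (⟦ m ⟧ˡ ∙ ⟦ w ⟧ʷ)  ≡⟨ assoc _ _ _ ⟨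
      (⟦ flip m ⟧ˡ ∙ ⟦ m ⟧ˡ) ∙ ⟦ w ⟧ʷ  ≡⟨ cong (_∙ ⟦ w ⟧ʷ) (flip-cancel m) ⟩
      ε ∙ ⟦ w ⟧ʷ                      ≡⟨ identityˡ _ ⟩
      ⟦ w ⟧ʷ                          ∎)
      where open ≡-Reasoning
    ... | no _  = refl

    ·ʷ-sound : ∀ u w → ⟦ u ·ʷ w ⟧ʷ ≡ ⟦ u ⟧ʷ ∙ ⟦ w ⟧ʷ
    ·ʷ-sound []      w = sym (identityˡ _)
    ·ʷ-sound (l ∷ u) w = begin
      ⟦ push l (u ·ʷ w) ⟧ʷ         ≡⟨ push-sound l (u ·ʷ w) ⟩
      ⟦ l ⟧ˡ ∙ ⟦ u ·ʷ w ⟧ʷ          ≡⟨ cong (⟦ l ⟧ˡ ∙_) (·ʷ-sound u w) ⟩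
      ⟦ l ⟧ˡ ∙ (⟦ u ⟧ʷ ∙ ⟦ w ⟧ʷ)    ≡⟨ assoc _ _ _ ⟨
      (⟦ l ⟧ˡ ∙ ⟦ u ⟧ʷ) ∙ ⟦ w ⟧ʷ    ∎
      where open ≡-Reasoning

    invʷ-sound : ∀ w → ⟦ invʷ w ⟧ʷ ≡ ⟦ w ⟧ʷ ⁻¹
    invʷ-sound []      = sym ε⁻¹≈ε
    invʷ-sound (l ∷ w) = begin
      ⟦ invʷ w ·ʷ (flip l ∷ []) ⟧ʷ      ≡⟨ ·ʷ-sound (invʷ w) (flip l ∷ []) ⟩
      ⟦ invʷ w ⟧ʷ ∙ (⟦ flip l ⟧ˡ ∙ ε)   ≡⟨ cong₂ _∙_ (invʷ-sound w) (trans (identityʳ _) (flip-sound l)) ⟩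
      (⟦ w ⟧ʷ ⁻¹) ∙ (⟦ l ⟧ˡ ⁻¹)         ≡⟨ ⁻¹-anti-homo-∙ _ _ ⟨
      (⟦ l ⟧ˡ ∙ ⟦ w ⟧ʷ) ⁻¹              ∎
      where open ≡-Reasoning

    normalise-sound : ∀ x → ⟦ normalise x ⟧ʷ ≡ ⟦ x ⟧ ρ
    normalise-sound (var i) = identityʳ _
    normalise-sound unit    = refl
    normalise-sound (x ⊗ y) = trans (·ʷ-sound (normalise x) (normalise y))
                                    (cong₂ _∙_ (normalise-sound x) (normalise-sound y))
    normalise-sound (x ⁻)   = trans (invʷ-sound (normalise x)) (cong _⁻¹ (normalise-sound x))

  open import Relation.Binary.Reflection (setoid A) var ⟦_⟧ (λ x ρ → ⟦_⟧ʷ ρ (normalise x))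
    (λ x ρ → normalise-sound ρ x) public
    using (solve; _⊜_)

module FiniteGroup (G : FinGroup) where

  open FinGroup G using (e; isGroup)
    renaming (order to n; _∙_ to infixl 7 _∙_; _⁻¹ to infix 8 _⁻¹)
  open GroupSolver isGroup using (solve; _⊜_; _⊗_; _⁻; unit)

  ⁻¹-involutive : ∀ x → x ⁻¹ ⁻¹ ≡ x
  ⁻¹-involutive = solve 1 (λ x → x ⁻ ⁻ ⊜ x) refl

  e⁻¹≡e : e ⁻¹ ≡ e
  e⁻¹≡e = solve 0 (unit ⁻ ⊜ unit) refl

  record IsSubgroupPred (L : Pred (Fin n) 0ℓ) : Set where
    field
      e∈        : L e
      ∙-closed  : ∀ {x y} → L x → L y → L (x ∙ y)
      ⁻¹-closed : ∀ {x} → L x → L (x ⁻¹)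

  isSubgroupPred : {H : Subset n} → IsSubgroup G H → IsSubgroupPred (_∈ H)
  isSubgroupPred (e∈H , ∙-closed , ⁻¹-closed) = record
    { e∈ = e∈H ; ∙-closed = ∙-closed _ _ ; ⁻¹-closed = ⁻¹-closed _ }

  count-⁻¹ : {X Y : Pred (Fin n) 0ℓ} (X? : Decidable X) (Y? : Decidable Y) →
             (∀ {g} → X g → Y (g ⁻¹)) → (∀ {g} → Y g → X (g ⁻¹)) → count X? ≡ count Y?
  count-⁻¹ X? Y? X⁻¹⊆Y Y⁻¹⊆X = count-bijection X? Y? _⁻¹ _⁻¹ X⁻¹⊆Y Y⁻¹⊆X ⁻¹-involutive ⁻¹-involutive

  module Cosets {L : Pred (Fin n) 0ℓ} (L? : Decidable L) (L-subgroup : IsSubgroupPred L) where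

    open IsSubgroupPred L-subgroup

    L-resp : ∀ {x y} → x ≡ y → L x → L y
    L-resp = subst L

    -- x ∼ y says that x and y lie in the same right coset: L x = L y.
    infix 4 _∼_ _∼?_
    _∼_ : Fin n → Fin n → Set
    x ∼ y = L (x ∙ y ⁻¹)

    _∼?_ : ∀ x y → Dec (x ∼ y)
    x ∼? y = L? (x ∙ y ⁻¹)

    ∼-refl : ∀ {x} → x ∼ x
    ∼-refl {x} = L-resp (sym (solve 1 (λ x → x ⊗ x ⁻ ⊜ unit) refl x)) e∈

    ∼-sym : ∀ {x y} → x ∼ y → y ∼ x
    ∼-sym {x} {y} x∼y = L-resp (solve 2 (λ x y → (x ⊗ y ⁻) ⁻ ⊜ y ⊗ x ⁻) refl x y) (⁻¹-closed x∼y)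

    ∼-trans : ∀ {x y z} → x ∼ y → y ∼ z → x ∼ z
    ∼-trans {x} {y} {z} x∼y y∼z =
      L-resp (solve 3 (λ x y z → x ⊗ y ⁻ ⊗ (y ⊗ z ⁻) ⊜ x ⊗ z ⁻) refl x y z) (∙-closed x∼y y∼z)

    ∼-∙ʳ : ∀ {x y} z → x ∼ y → x ∙ z ∼ y ∙ z
    ∼-∙ʳ {x} {y} z = L-resp (solve 3 (λ x y z → x ⊗ y ⁻ ⊜ x ⊗ z ⊗ (y ⊗ z) ⁻) refl x y z)

    ∈⇒∙ˡ-∼ : ∀ {h} x → L h → h ∙ x ∼ x
    ∈⇒∙ˡ-∼ {h} x = L-resp (solve 2 (λ h x → h ⊜ h ⊗ x ⊗ x ⁻) refl h x)

    ∈⇒∼e : ∀ {x} → L x → x ∼ e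
    ∈⇒∼e {x} = L-resp (solve 1 (λ x → x ⊜ x ⊗ unit ⁻) refl x)

    ∼e⇒∈ : ∀ {x} → x ∼ e → L x
    ∼e⇒∈ {x} = L-resp (solve 1 (λ x → x ⊗ unit ⁻ ⊜ x) refl x)

    count-coset : ∀ y → count (_∼? y) ≡ count L?
    count-coset y = count-bijection (_∼? y) L? (_∙ y ⁻¹) (_∙ y)
      (λ x∼y → x∼y)
      (λ {h} h∈L → L-resp (solve 2 (λ h y → h ⊜ h ⊗ y ⊗ y ⁻) refl h y) h∈L)
      (λ x → solve 2 (λ x y → x ⊗ y ⁻ ⊗ y ⊜ x) refl x y)
      (λ h → solve 2 (λ h y → h ⊗ y ⊗ y ⁻ ⊜ h) refl h y)

    Covers : Subset n → Pred (Fin n) 0ℓ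
    Covers T g = Σ[ t ∈ Fin n ] t ∈ T × g ∼ t

    covers? : ∀ T → Decidable (Covers T)
    covers? T g = any? (λ t → (t ∈? T) ×-dec (g ∼? t))

    covers-∼ : ∀ {T x y} → x ∼ y → Covers T y → Covers T x
    covers-∼ x∼y (t , t∈T , y∼t) = t , t∈T , ∼-trans x∼y y∼t

    covers-⊆ : ∀ {T T′} → (∀ {t} → t ∈ T → t ∈ T′) → Covers T ⊆ Covers T′
    covers-⊆ T⊆T′ (t , t∈T , g∼t) = t , T⊆T′ t∈T , g∼t

    covers-∪-singleton : ∀ {T s g} → Covers (T ∪ˢ ⁅ s ⁆) g → Covers T g ⊎ g ∼ s
    covers-∪-singleton {T} {s} (t , t∈ , g∼t) with x∈p∪q⁻ T ⁅ s ⁆ t∈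
    ... | inj₁ t∈T = inj₁ (t , t∈T , g∼t)
    ... | inj₂ t∈s = inj₂ (subst (_ ∼_) (x∈⁅y⁆⇒x≡y s t∈s) g∼t)

    IsPartialTransversal : Subset n → Set
    IsPartialTransversal T = ∀ {t t′} → t ∈ T → t′ ∈ T → t ∼ t′ → t ≡ t′

    ∪-singleton-isPartialTransversal : ∀ {T s} → IsPartialTransversal T → ¬ Covers T s →
                                       IsPartialTransversal (T ∪ˢ ⁅ s ⁆)
    ∪-singleton-isPartialTransversal {T} {s} transversal s-new t∈ t′∈ t∼t′
      with x∈p∪q⁻ T ⁅ s ⁆ t∈ | x∈p∪q⁻ T ⁅ s ⁆ t′∈
    ... | inj₁ t∈T | inj₁ t′∈T = transversal t∈T t′∈T t∼t′
    ... | inj₁ t∈T | inj₂ t′∈s =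
      contradiction (_ , t∈T , ∼-sym (subst (_ ∼_) (x∈⁅y⁆⇒x≡y s t′∈s) t∼t′)) s-new
    ... | inj₂ t∈s | inj₁ t′∈T =
      contradiction (_ , t′∈T , subst (_∼ _) (x∈⁅y⁆⇒x≡y s t∈s) t∼t′) s-new
    ... | inj₂ t∈s | inj₂ t′∈s = trans (x∈⁅y⁆⇒x≡y s t∈s) (sym (x∈⁅y⁆⇒x≡y s t′∈s))

    CosetClosed : Pred (Fin n) 0ℓ → Set
    CosetClosed X = ∀ {x y} → x ∼ y → X y → X x

    count-transversal : ∀ {T} {X : Pred (Fin n) 0ℓ} (X? : Decidable X) → CosetClosed X →
                        IsPartialTransversal T →
                        count (X? ∩? (_∈? T)) * count L? ≡ count (X? ∩? covers? T)
    count-transversal {T} {X} X? X-closed transversal =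
      trans (count-double (X? ∩? (_∈? T)) (X? ∩? covers? T) (λ t g → g ∼? t) coset unique)
            (*-identityʳ (count (X? ∩? covers? T)))
      where
      coset : ∀ {t} → X t × t ∈ T → count ((X? ∩? covers? T) ∩? (_∼? t)) ≡ count L?
      coset {t} (Xt , t∈T) = trans
        (count-cong ((X? ∩? covers? T) ∩? (_∼? t)) (_∼? t)
                    proj₂ (λ g∼t → (X-closed g∼t Xt , t , t∈T , g∼t) , g∼t))
        (count-coset t)
      unique : ∀ {g} → X g × Covers T g → count ((X? ∩? (_∈? T)) ∩? (g ∼?_)) ≡ 1
      unique {g} (Xg , t , t∈T , g∼t) = count-unique ((X? ∩? (_∈? T)) ∩? (g ∼?_))
        ((X-closed (∼-sym g∼t) Xg , t∈T) , g∼t)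
        (λ ((_ , t′∈T) , g∼t′) → transversal t′∈T t∈T (∼-trans (∼-sym g∼t′) g∼t))

    complete-transversal :
      (Inv : Subset n → Set) →
      (∀ {T a} → Inv T → ¬ Covers T a →
         Σ[ T′ ∈ Subset n ] Inv T′ × (∀ {t} → t ∈ T → t ∈ T′) × Covers T′ a) →
      ∀ {T} → Inv T → Σ[ T′ ∈ Subset n ] Inv T′ × (∀ g → Covers T′ g)
    complete-transversal Inv extend {T} inv = go (count (∁? (covers? T))) inv ≤-refl
      where
      go : ∀ k {T} → Inv T → count (∁? (covers? T)) ≤ k →
           Σ[ T′ ∈ Subset n ] Inv T′ × (∀ g → Covers T′ g)
      go k {T} inv bound with any? (∁? (covers? T))
      ... | no nothing-uncovered =
        T , inv , λ g → decidable-stable (covers? T g) (λ ¬cov → nothing-uncovered (g , ¬cov))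
      go zero    {T} inv bound | yes (a , ¬cov) =
        contradiction (<-≤-trans (count-pos (∁? (covers? T)) ¬cov) bound) λ ()
      go (suc k) {T} inv bound | yes (a , ¬cov) with extend inv ¬cov
      ... | T′ , inv′ , T⊆T′ , cov-a = go k inv′ (s≤s⁻¹ (<-≤-trans fewer-uncovered bound))
        where
        fewer-uncovered : count (∁? (covers? T′)) < count (∁? (covers? T))
        fewer-uncovered = count-< (∁? (covers? T′)) (∁? (covers? T))
          (λ ¬cov′ cov → ¬cov′ (covers-⊆ T⊆T′ cov)) ¬cov (λ ¬cov′ → ¬cov′ cov-a)

    ∪-uncovered-isPartialTransversal :
      ∀ {T a} → IsPartialTransversal T → ¬ Covers T a →
      Σ[ T′ ∈ Subset n ] IsPartialTransversal T′ × (∀ {t} → t ∈ T → t ∈ T′) × Covers T′ a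
    ∪-uncovered-isPartialTransversal {T} {a} transversal a-new =
      T ∪ˢ ⁅ a ⁆ , ∪-singleton-isPartialTransversal transversal a-new ,
      x∈p∪q⁺ ∘ inj₁ , a , x∈p∪q⁺ (inj₂ (x∈⁅x⁆ a)) , ∼-refl

    count-complete-transversal : ∀ {T} → IsPartialTransversal T → (∀ g → Covers T g) →
                          count (U? ∩? (_∈? T)) * count L? ≡ n
    count-complete-transversal {T} transversal covered = begin
      count (U? ∩? (_∈? T)) * count L?   ≡⟨ count-transversal U? (λ _ _ → tt) transversal ⟩
      count (U? ∩? covers? T)            ≡⟨ count-cong (U? ∩? covers? T) U? proj₁ (λ {g} _ → tt , covered g) ⟩
      count (U? {A = Fin n})             ≡⟨ count-U n ⟩
      n                                  ∎
      where open ≡-Reasoning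

    lagrange : count L? ∣ n
    lagrange =
      let T , transversal , covered = complete-transversal IsPartialTransversal
                                        ∪-uncovered-isPartialTransversal {∅ˢ} (λ t∈∅ → contradiction t∈∅ ∉⊥)
      in divides (count (U? ∩? (_∈? T))) (sym (count-complete-transversal transversal covered))

    -- L x L, as the union of the right cosets L (x ∙ h), h ∈ L.
    DoubleCoset : Fin n → Pred (Fin n) 0ℓ
    DoubleCoset x g = Σ[ h ∈ Fin n ] L h × g ∼ x ∙ h

    doubleCoset? : ∀ x → Decidable (DoubleCoset x)
    doubleCoset? x g = any? (λ h → L? h ×-dec (g ∼? x ∙ h))

    doubleCoset-closed : ∀ {x} → CosetClosed (DoubleCoset x)
    doubleCoset-closed g∼y (h , h∈L , y∼xh) = h , h∈L , ∼-trans g∼y y∼xh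

    ∈doubleCoset : ∀ x → DoubleCoset x x
    ∈doubleCoset x = e , e∈ , L-resp (solve 1 (λ x → unit ⊜ x ⊗ (x ⊗ unit) ⁻) refl x) e∈

    doubleCoset-⊆ : ∀ {x y} → DoubleCoset x y → DoubleCoset y ⊆ DoubleCoset x
    doubleCoset-⊆ {x} {y} (h , h∈L , y∼xh) {g} (k , k∈L , g∼yk) =
      h ∙ k , ∙-closed h∈L k∈L ,
      ∼-trans g∼yk (subst (y ∙ k ∼_) (solve 3 (λ x h k → x ⊗ h ⊗ k ⊜ x ⊗ (h ⊗ k)) refl x h k)
                          (∼-∙ʳ k y∼xh))

    doubleCoset-⁻¹ : ∀ {x g} → DoubleCoset x g → DoubleCoset (x ⁻¹) (g ⁻¹)
    doubleCoset-⁻¹ {x} {g} (h , h∈L , g∼xh) =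
      (g ∙ (x ∙ h) ⁻¹) ⁻¹ , ⁻¹-closed g∼xh ,
      L-resp (solve 3 (λ x g h → h ⁻ ⊜ g ⁻ ⊗ (x ⁻ ⊗ (g ⊗ (x ⊗ h) ⁻) ⁻) ⁻) refl x g h) (⁻¹-closed h∈L)

    doubleCoset-⁻¹⁻¹ : ∀ {x g} → DoubleCoset (x ⁻¹) g → DoubleCoset x (g ⁻¹)
    doubleCoset-⁻¹⁻¹ {x} {g} = subst (λ y → DoubleCoset y (g ⁻¹)) (⁻¹-involutive x) ∘ doubleCoset-⁻¹

    doubleCoset-e : ∀ {x} → DoubleCoset x e → L x
    doubleCoset-e {x} (h , h∈L , e∼xh) =
      L-resp (solve 2 (λ x h → (unit ⊗ (x ⊗ h) ⁻) ⁻ ⊗ h ⁻ ⊜ x) refl x h)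
             (∙-closed (⁻¹-closed e∼xh) (⁻¹-closed h∈L))

    ConjugateIntersection : Fin n → Pred (Fin n) 0ℓ
    ConjugateIntersection x κ = L κ × L (x ∙ κ ∙ x ⁻¹)

    conjugateIntersection? : ∀ x → Decidable (ConjugateIntersection x)
    conjugateIntersection? x κ = L? κ ×-dec L? (x ∙ κ ∙ x ⁻¹)

    count-doubleCoset : ∀ x → count L? * count L? ≡ count (doubleCoset? x) * count (conjugateIntersection? x)
    count-doubleCoset x = count-double L? (doubleCoset? x) (λ k z → z ∼? x ∙ k) cosets intersections
      where
      cosets : ∀ {k} → L k → count (doubleCoset? x ∩? (_∼? x ∙ k)) ≡ count L?
      cosets {k} k∈L = trans
        (count-cong (doubleCoset? x ∩? (_∼? x ∙ k)) (_∼? x ∙ k)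
                    proj₂ (λ z∼xk → (k , k∈L , z∼xk) , z∼xk))
        (count-coset (x ∙ k))
      intersections : ∀ {z} → DoubleCoset x z →
                      count (L? ∩? (λ k → z ∼? x ∙ k)) ≡ count (conjugateIntersection? x)
      intersections {z} (h , h∈L , z∼xh) =
        count-bijection (L? ∩? (λ k → z ∼? x ∙ k)) (conjugateIntersection? x)
          (λ k → h ∙ k ⁻¹) (λ κ → κ ⁻¹ ∙ h) to from
          (λ k → solve 2 (λ h k → (h ⊗ k ⁻) ⁻ ⊗ h ⊜ k) refl h k)
          (λ κ → solve 2 (λ h κ → h ⊗ (κ ⁻ ⊗ h) ⁻ ⊜ κ) refl h κ)
        where
        to : ∀ {k} → L k × z ∼ x ∙ k → ConjugateIntersection x (h ∙ k ⁻¹)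
        to {k} (k∈L , z∼xk) =
          ∙-closed h∈L (⁻¹-closed k∈L) ,
          L-resp (solve 3 (λ x h k → x ⊗ h ⊗ (x ⊗ k) ⁻ ⊜ x ⊗ (h ⊗ k ⁻) ⊗ x ⁻) refl x h k)
                 (∼-trans (∼-sym z∼xh) z∼xk)
        from : ∀ {κ} → ConjugateIntersection x κ → L (κ ⁻¹ ∙ h) × z ∼ x ∙ (κ ⁻¹ ∙ h)
        from {κ} (κ∈L , xκx⁻¹∈L) =
          ∙-closed (⁻¹-closed κ∈L) h∈L ,
          ∼-trans z∼xh
            (L-resp (solve 3 (λ x h κ → x ⊗ κ ⊗ x ⁻ ⊜ x ⊗ h ⊗ (x ⊗ (κ ⁻ ⊗ h)) ⁻) refl x h κ) xκx⁻¹∈L)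

    ∪-coset-isSubgroup : ∀ {y} → L (y ∙ y) → (∀ {h} → L h → L (y ∙ h ∙ y ⁻¹)) →
                         IsSubgroupPred (L ∪ (_∼ y))
    ∪-coset-isSubgroup {y} y²∈L normalises = record
      { e∈ = inj₁ e∈ ; ∙-closed = closed-∙ ; ⁻¹-closed = closed-⁻¹ }
      where
      closed-∙ : ∀ {a b} → (L ∪ (_∼ y)) a → (L ∪ (_∼ y)) b → (L ∪ (_∼ y)) (a ∙ b)
      closed-∙ (inj₁ a∈L) (inj₁ b∈L) = inj₁ (∙-closed a∈L b∈L)
      closed-∙ {a} {b} (inj₁ a∈L) (inj₂ b∼y) = inj₂ (∼-trans (∈⇒∙ˡ-∼ b a∈L) b∼y)
      closed-∙ {a} {b} (inj₂ a∼y) (inj₁ b∈L) =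
        inj₂ (L-resp (solve 3 (λ a b y → a ⊗ y ⁻ ⊗ (y ⊗ b ⊗ y ⁻) ⊜ a ⊗ b ⊗ y ⁻) refl a b y)
                     (∙-closed a∼y (normalises b∈L)))
      closed-∙ {a} {b} (inj₂ a∼y) (inj₂ b∼y) =
        inj₁ (L-resp (solve 3 (λ a b y → a ⊗ y ⁻ ⊗ (y ⊗ (b ⊗ y ⁻) ⊗ y ⁻) ⊗ (y ⊗ y) ⊜ a ⊗ b)
                              refl a b y)
                     (∙-closed (∙-closed a∼y (normalises b∼y)) y²∈L))
      closed-⁻¹ : ∀ {a} → (L ∪ (_∼ y)) a → (L ∪ (_∼ y)) (a ⁻¹)
      closed-⁻¹ (inj₁ a∈L) = inj₁ (⁻¹-closed a∈L)
      closed-⁻¹ {a} (inj₂ a∼y) =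
        inj₂ (L-resp (solve 2 (λ a y → (y ⊗ y) ⁻ ⊗ (y ⊗ (a ⊗ y ⁻) ⁻ ⊗ y ⁻) ⊜ a ⁻ ⊗ y ⁻) refl a y)
                     (∙-closed (⁻¹-closed y²∈L) (normalises (⁻¹-closed a∼y))))

    count-∪-coset : ∀ {y} → ¬ L y → count (L? ∪? (_∼? y)) ≡ count L? + count L?
    count-∪-coset {y} y∉L = trans (count-∪-disjoint L? (_∼? y) disjoint) (cong (count L? +_) (count-coset y))
      where
      disjoint : ∀ {g} → L g → ¬ g ∼ y
      disjoint g∈L g∼y = y∉L (∼e⇒∈ (∼-trans (∼-sym g∼y) (∈⇒∼e g∈L)))

    oddIndex⇒normalises : ∀ α {y k} → count L? ≡ 2 ^ α → ¬ 2 ∣ k →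
                          count (doubleCoset? y) ≡ k * count L? → ∀ {h} → L h → L (y ∙ h ∙ y ⁻¹)
    oddIndex⇒normalises α {y} {k} |L|≡2^α k-odd |LyL|≡k|L| h∈L =
      proj₂ (count-≡⇒⊇ (conjugateIntersection? y) L? proj₁ |K|≡|L| h∈L)
      where
      open ≡-Reasoning
      |L| |K| : ℕ
      |L| = count L?
      |K| = count (conjugateIntersection? y)
      |L|≡k|K| : |L| ≡ k * |K|
      |L|≡k|K| = *-cancelˡ-≡ |L| (k * |K|) |L| {{>-nonZero (count-pos L? e∈)}} (begin
        |L| * |L|                     ≡⟨ count-doubleCoset y ⟩
        count (doubleCoset? y) * |K|  ≡⟨ cong (_* |K|) |LyL|≡k|L| ⟩
        k * |L| * |K|                 ≡⟨ cong (_* |K|) (*-comm k |L|) ⟩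
        |L| * k * |K|                 ≡⟨ *-assoc |L| k |K| ⟩
        |L| * (k * |K|)               ∎)
      |K|≡|L| : |K| ≡ |L|
      |K|≡|L| = begin
        |K|          ≡⟨ +-identityʳ |K| ⟨
        1 * |K|      ≡⟨ cong (_* |K|) (odd-factor-of-2^ α (trans (sym |L|≡k|K|) |L|≡2^α) k-odd) ⟨
        k * |K|      ≡⟨ |L|≡k|K| ⟨
        |L|          ∎

  module PerfectCodes {H : Subset n} (H-subgroup : IsSubgroup G H) where

    open IsSubgroupPred (isSubgroupPred H-subgroup)
    open Cosets (_∈? H) (isSubgroupPred H-subgroup)

    isPerfectCode-of-transversal : ∀ {T} → e ∈ T → (∀ {t} → t ∈ T → t ⁻¹ ∈ T) →
                                   IsPartialTransversal T → (∀ g → Covers T g) → IsPerfectCodeOf G H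
    isPerfectCode-of-transversal {T} e∈T T-⁻¹ transversal covered = S , (e∉S , S-⁻¹) , perfect
      where
      S : Subset n
      S = T - e
      S⊆T : ∀ {x} → x ∈ S → x ∈ T
      S⊆T = p─q⊆p T ⁅ e ⁆
      e∉S : e ∉ S
      e∉S e∈S = x∈p-y⇒x≢y T e∈S refl
      S-⁻¹ : ∀ x → x ∈ S → x ⁻¹ ∈ S
      S-⁻¹ x x∈S = x∈p∧x≢y⇒x∈p-y (T-⁻¹ (S⊆T x∈S))
        λ x⁻¹≡e → x∈p-y⇒x≢y T x∈S (trans (sym (⁻¹-involutive x)) (trans (cong _⁻¹ x⁻¹≡e) e⁻¹≡e))
      dist⇒∈T : ∀ {x c} → Dist≤1 G S x c → c ∙ x ⁻¹ ∈ T
      dist⇒∈T {x} (inj₁ refl) = subst (_∈ T) (solve 1 (λ x → unit ⊜ x ⊗ x ⁻) refl x) e∈T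
      dist⇒∈T (inj₂ adjacent) = S⊆T adjacent
      perfect : IsPerfectCodeIn G S H
      perfect x with covered (x ⁻¹)
      ... | t , t∈T , x⁻¹∼t = t ∙ x , tx∈H , distance , unique
        where
        tx∈H : t ∙ x ∈ H
        tx∈H = subst (_∈ H) (solve 2 (λ x t → (x ⁻ ⊗ t ⁻) ⁻ ⊜ t ⊗ x) refl x t) (⁻¹-closed x⁻¹∼t)
        distance : Dist≤1 G S x (t ∙ x)
        distance with t ≟ e
        ... | yes refl = inj₁ (solve 1 (λ x → x ⊜ unit ⊗ x) refl x)
        ... | no t≢e   = inj₂ (subst (_∈ S) (solve 2 (λ t x → t ⊜ t ⊗ x ⊗ x ⁻) refl t x)
                                           (x∈p∧x≢y⇒x∈p-y t∈T t≢e))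
        unique : ∀ c → c ∈ H → Dist≤1 G S x c → c ≡ t ∙ x
        unique c c∈H dist = begin
          c                 ≡⟨ solve 2 (λ c x → c ⊜ c ⊗ x ⁻ ⊗ x) refl c x ⟩
          c ∙ x ⁻¹ ∙ x      ≡⟨ cong (_∙ x) (transversal (dist⇒∈T dist) t∈T cx⁻¹∼t) ⟩
          t ∙ x             ∎
          where
          open ≡-Reasoning
          cx⁻¹∼t : c ∙ x ⁻¹ ∼ t
          cx⁻¹∼t = subst (_∈ H) (solve 3 (λ c t x → c ⊗ (t ⊗ x) ⁻ ⊜ c ⊗ x ⁻ ⊗ t ⁻) refl c t x)
                          (∙-closed c∈H (⁻¹-closed tx∈H))

    record IsSymmetricTransversal (T : Subset n) : Set where
      field
        e∈T             : e ∈ T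
        inverse-closed  : ∀ {t} → t ∈ T → t ⁻¹ ∈ T
        partial         : IsPartialTransversal T
        involution-free : ∀ {t} → t ∈ T → t ⁻¹ ≡ t → t ≡ e

    ⁅e⁆-isSymmetricTransversal : IsSymmetricTransversal ⁅ e ⁆
    ⁅e⁆-isSymmetricTransversal = record
      { e∈T             = x∈⁅x⁆ e
      ; inverse-closed  = inverse-closed′
      ; partial         = λ t∈⁅e⁆ t′∈⁅e⁆ _ → trans (x∈⁅y⁆⇒x≡y e t∈⁅e⁆) (sym (x∈⁅y⁆⇒x≡y e t′∈⁅e⁆))
      ; involution-free = λ t∈⁅e⁆ _ → x∈⁅y⁆⇒x≡y e t∈⁅e⁆
      }
      where
      inverse-closed′ : ∀ {t} → t ∈ ⁅ e ⁆ → t ⁻¹ ∈ ⁅ e ⁆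
      inverse-closed′ t∈⁅e⁆ rewrite x∈⁅y⁆⇒x≡y e t∈⁅e⁆ | e⁻¹≡e = x∈⁅x⁆ e

    adjoinPair : Subset n → Fin n → Subset n
    adjoinPair T t = (T ∪ˢ ⁅ t ⁆) ∪ˢ ⁅ t ⁻¹ ⁆

    ⊆-adjoinPair : ∀ {T t x} → x ∈ T → x ∈ adjoinPair T t
    ⊆-adjoinPair x∈T = x∈p∪q⁺ (inj₁ (x∈p∪q⁺ (inj₁ x∈T)))

    ∈-adjoinPair : ∀ {T} t → t ∈ adjoinPair T t
    ∈-adjoinPair t = x∈p∪q⁺ (inj₁ (x∈p∪q⁺ (inj₂ (x∈⁅x⁆ t))))

    ∪-pair-isSymmetricTransversal :
      ∀ {T a b t} → IsSymmetricTransversal T → ¬ Covers T a → ¬ Covers T b → ¬ a ∼ b →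
      t ∼ a → t ⁻¹ ∼ b → IsSymmetricTransversal (adjoinPair T t)
    ∪-pair-isSymmetricTransversal {T} {a} {b} {t} symT a-new b-new a≁b t∼a t⁻¹∼b = record
      { e∈T             = ⊆-adjoinPair (e∈T symT)
      ; inverse-closed  = inverse-closed′
      ; partial         = ∪-singleton-isPartialTransversal
                            (∪-singleton-isPartialTransversal (partial symT) t-new) t⁻¹-new
      ; involution-free = involution-free′
      }
      where
      open IsSymmetricTransversal
      T′ : Subset n
      T′ = adjoinPair T t
      t⁻¹∈T′ : t ⁻¹ ∈ T′
      t⁻¹∈T′ = x∈p∪q⁺ (inj₂ (x∈⁅x⁆ (t ⁻¹)))
      cases : ∀ {x} → x ∈ T′ → x ∈ T ⊎ x ≡ t ⊎ x ≡ t ⁻¹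
      cases x∈T′ with x∈p∪q⁻ (T ∪ˢ ⁅ t ⁆) ⁅ t ⁻¹ ⁆ x∈T′
      ... | inj₂ x∈⁅t⁻¹⁆ = inj₂ (inj₂ (x∈⁅y⁆⇒x≡y _ x∈⁅t⁻¹⁆))
      ... | inj₁ x∈T∪⁅t⁆ with x∈p∪q⁻ T ⁅ t ⁆ x∈T∪⁅t⁆
      ...   | inj₁ x∈T   = inj₁ x∈T
      ...   | inj₂ x∈⁅t⁆ = inj₂ (inj₁ (x∈⁅y⁆⇒x≡y t x∈⁅t⁆))
      t≁t⁻¹ : ¬ t ∼ t ⁻¹
      t≁t⁻¹ t∼t⁻¹ = a≁b (∼-trans (∼-sym t∼a) (∼-trans t∼t⁻¹ t⁻¹∼b))
      t-new : ¬ Covers T t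
      t-new cov = a-new (covers-∼ (∼-sym t∼a) cov)
      t⁻¹-new : ¬ Covers (T ∪ˢ ⁅ t ⁆) (t ⁻¹)
      t⁻¹-new cov with covers-∪-singleton cov
      ... | inj₁ cov-T = b-new (covers-∼ (∼-sym t⁻¹∼b) cov-T)
      ... | inj₂ t⁻¹∼t = t≁t⁻¹ (∼-sym t⁻¹∼t)
      inverse-closed′ : ∀ {x} → x ∈ T′ → x ⁻¹ ∈ T′
      inverse-closed′ x∈T′ with cases x∈T′
      ... | inj₁ x∈T        = ⊆-adjoinPair (inverse-closed symT x∈T)
      ... | inj₂ (inj₁ refl) = t⁻¹∈T′
      ... | inj₂ (inj₂ refl) = subst (_∈ T′) (sym (⁻¹-involutive t)) (∈-adjoinPair t)
      t⁻¹≢t : t ⁻¹ ≢ t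
      t⁻¹≢t t⁻¹≡t = t≁t⁻¹ (subst (t ∼_) (sym t⁻¹≡t) ∼-refl)
      involution-free′ : ∀ {x} → x ∈ T′ → x ⁻¹ ≡ x → x ≡ e
      involution-free′ x∈T′ x⁻¹≡x with cases x∈T′
      ... | inj₁ x∈T        = involution-free symT x∈T x⁻¹≡x
      ... | inj₂ (inj₁ refl) = contradiction x⁻¹≡x t⁻¹≢t
      ... | inj₂ (inj₂ refl) = contradiction (trans (sym x⁻¹≡x) (⁻¹-involutive t)) t⁻¹≢t

    OddIndex : Fin n → Set
    OddIndex y = Σ[ k ∈ ℕ ] ¬ 2 ∣ k × count (doubleCoset? y) ≡ k * count (_∈? H)

    OddSquareCondition : Set
    OddSquareCondition = ∀ y → y ∙ y ∈ H → OddIndex y → y ∈ H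

    module Unpaired {T} (symT : IsSymmetricTransversal T) {a} (a-new : ¬ Covers T a)
                    (unpaired : ∀ {b} → DoubleCoset (a ⁻¹) b → ¬ b ∼ a → Covers T b) where

      open IsSymmetricTransversal symT

      HaH? : Decidable (DoubleCoset a)
      HaH? = doubleCoset? a

      Ha⁻¹H? : Decidable (DoubleCoset (a ⁻¹))
      Ha⁻¹H? = doubleCoset? (a ⁻¹)

      a∉H : a ∉ H
      a∉H a∈H = a-new (e , e∈T , ∈⇒∼e a∈H)

      -- Otherwise inversion matches H a H with H a⁻¹ H, which T covers completely.
      a∈Ha⁻¹H : DoubleCoset (a ⁻¹) a
      a∈Ha⁻¹H = decidable-stable (Ha⁻¹H? a) λ a∉Ha⁻¹H → <-irrefl (covered≡all a∉Ha⁻¹H) fewer-covered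
        where
        covered≡all : ¬ DoubleCoset (a ⁻¹) a → count (HaH? ∩? covers? T) ≡ count HaH?
        covered≡all a∉Ha⁻¹H = begin
          count (HaH? ∩? covers? T)                  ≡⟨ count-transversal HaH? doubleCoset-closed partial ⟨
          count (HaH? ∩? (_∈? T)) * count (_∈? H)    ≡⟨ cong (_* count (_∈? H)) inverses ⟩
          count (Ha⁻¹H? ∩? (_∈? T)) * count (_∈? H)   ≡⟨ count-transversal Ha⁻¹H? doubleCoset-closed partial ⟩
          count (Ha⁻¹H? ∩? covers? T)                 ≡⟨ count-cong (Ha⁻¹H? ∩? covers? T) Ha⁻¹H?
                                                             proj₁ (λ d → d , Ha⁻¹H-covered d) ⟩
          count Ha⁻¹H?                                ≡⟨ count-⁻¹ Ha⁻¹H? HaH? doubleCoset-⁻¹⁻¹ doubleCoset-⁻¹ ⟩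
          count HaH?                                 ∎
          where
          open ≡-Reasoning
          Ha⁻¹H-covered : DoubleCoset (a ⁻¹) ⊆ Covers T
          Ha⁻¹H-covered b∈Ha⁻¹H =
            unpaired b∈Ha⁻¹H (λ b∼a → a∉Ha⁻¹H (doubleCoset-closed (∼-sym b∼a) b∈Ha⁻¹H))
          inverses : count (HaH? ∩? (_∈? T)) ≡ count (Ha⁻¹H? ∩? (_∈? T))
          inverses = count-⁻¹ (HaH? ∩? (_∈? T)) (Ha⁻¹H? ∩? (_∈? T))
            (λ (d , t∈T) → doubleCoset-⁻¹ d , inverse-closed t∈T)
            (λ (d , t∈T) → doubleCoset-⁻¹⁻¹ d , inverse-closed t∈T)
        fewer-covered : count (HaH? ∩? covers? T) < count HaH?
        fewer-covered = count-< (HaH? ∩? covers? T) HaH? proj₁ (∈doubleCoset a) (a-new ∘ proj₂)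

      odd-index : OddIndex (a ⁻¹)
      odd-index = suc c , 2∣n⇒2∤1+n c-even , (begin
        count Ha⁻¹H?                                                   ≡⟨ count-split Ha⁻¹H? (covers? T) ⟩
        count (Ha⁻¹H? ∩? covers? T) + count (Ha⁻¹H? ∩? ∁? (covers? T))    ≡⟨ cong₂ _+_ covered uncovered ⟩
        c * count (_∈? H) + count (_∈? H)                           ≡⟨ +-comm _ (count (_∈? H)) ⟩
        suc c * count (_∈? H)                                       ∎)
        where
        open ≡-Reasoning
        c : ℕ
        c = count (Ha⁻¹H? ∩? (_∈? T))
        Ha⁻¹H-⁻¹ : ∀ {g} → DoubleCoset (a ⁻¹) g → DoubleCoset (a ⁻¹) (g ⁻¹)
        Ha⁻¹H-⁻¹ d = doubleCoset-⊆ a∈Ha⁻¹H (doubleCoset-⁻¹⁻¹ d)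
        e∉Ha⁻¹H : ¬ DoubleCoset (a ⁻¹) e
        e∉Ha⁻¹H e∈Ha⁻¹H = a∉H (subst (_∈ H) (⁻¹-involutive a) (⁻¹-closed (doubleCoset-e e∈Ha⁻¹H)))
        c-even : 2 ∣ c
        c-even = count-even (Ha⁻¹H? ∩? (_∈? T)) _⁻¹ ⁻¹-involutive
          (λ (d , t∈T) → Ha⁻¹H-⁻¹ d , inverse-closed t∈T)
          (λ (d , t∈T) t⁻¹≡t → e∉Ha⁻¹H (subst (DoubleCoset (a ⁻¹)) (involution-free t∈T t⁻¹≡t) d))
        covered : count (Ha⁻¹H? ∩? covers? T) ≡ c * count (_∈? H)
        covered = sym (count-transversal Ha⁻¹H? doubleCoset-closed partial)
        uncovered : count (Ha⁻¹H? ∩? ∁? (covers? T)) ≡ count (_∈? H)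
        uncovered = trans (count-cong (Ha⁻¹H? ∩? ∁? (covers? T)) (_∼? a) in-a a-coset) (count-coset a)
          where
          in-a : ∀ {b} → DoubleCoset (a ⁻¹) b × ¬ Covers T b → b ∼ a
          in-a {b} (d , b-new) = decidable-stable (b ∼? a) (λ b≁a → b-new (unpaired d b≁a))
          a-coset : ∀ {b} → b ∼ a → DoubleCoset (a ⁻¹) b × ¬ Covers T b
          a-coset b∼a = doubleCoset-closed b∼a a∈Ha⁻¹H , (λ cov → a-new (covers-∼ (∼-sym b∼a) cov))

      ¬oddSquareCondition : ¬ OddSquareCondition
      ¬oddSquareCondition condition = a∉H (root-in-H a∈Ha⁻¹H odd-index)
        where
        root-in-H : DoubleCoset (a ⁻¹) a → OddIndex (a ⁻¹) → a ∈ H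
        root-in-H (h , h∈H , a∼a⁻¹h) (k , k-odd , |Ha⁻¹H|≡k|H|) =
          subst (_∈ H) (solve 2 (λ a h → (a ⁻ ⊗ h ⊗ h ⁻) ⁻ ⊜ a) refl a h)
                       (⁻¹-closed (∙-closed y∈H (⁻¹-closed h∈H)))
          where
          y : Fin n
          y = a ⁻¹ ∙ h
          y²∈H : y ∙ y ∈ H
          y²∈H = subst (_∈ H)
            (solve 2 (λ a h → (a ⊗ (a ⁻ ⊗ h) ⁻) ⁻ ⊗ h ⊜ a ⁻ ⊗ h ⊗ (a ⁻ ⊗ h)) refl a h)
            (∙-closed (⁻¹-closed a∼a⁻¹h) h∈H)
          a⁻¹∈HyH : DoubleCoset y (a ⁻¹)
          a⁻¹∈HyH = h ⁻¹ , ⁻¹-closed h∈H ,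
                    subst (a ⁻¹ ∼_) (solve 2 (λ a h → a ⁻ ⊜ a ⁻ ⊗ h ⊗ h ⁻) refl a h) ∼-refl
          HyH≡Ha⁻¹H : count (doubleCoset? y) ≡ count Ha⁻¹H?
          HyH≡Ha⁻¹H = count-cong (doubleCoset? y) Ha⁻¹H?
            (doubleCoset-⊆ (h , h∈H , ∼-refl)) (doubleCoset-⊆ a⁻¹∈HyH)
          y∈H : y ∈ H
          y∈H = condition y y²∈H (k , k-odd , trans HyH≡Ha⁻¹H |Ha⁻¹H|≡k|H|)

    extend-symmetricTransversal :
      OddSquareCondition → ∀ {T a} → IsSymmetricTransversal T → ¬ Covers T a →
      Σ[ T′ ∈ Subset n ] IsSymmetricTransversal T′ × (∀ {t} → t ∈ T → t ∈ T′) × Covers T′ a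
    extend-symmetricTransversal condition {T} {a} symT a-new
      with any? (λ b → ∁? (covers? T) b ×-dec doubleCoset? (a ⁻¹) b ×-dec ∁? (_∼? a) b)
    ... | no none = contradiction condition (Unpaired.¬oddSquareCondition symT a-new unpaired)
      where
      unpaired : ∀ {b} → DoubleCoset (a ⁻¹) b → ¬ b ∼ a → Covers T b
      unpaired {b} d b≁a = decidable-stable (covers? T b) (λ b-new → none (b , b-new , d , b≁a))
    ... | yes (b , b-new , (h , h∈H , b∼a⁻¹h) , b≁a) =
      adjoinPair T t , ∪-pair-isSymmetricTransversal symT a-new b-new (b≁a ∘ ∼-sym) t∼a t⁻¹∼b ,
      ⊆-adjoinPair , t , ∈-adjoinPair t , ∼-sym t∼a
      where
      t : Fin n
      t = h ⁻¹ ∙ a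
      t∼a : t ∼ a
      t∼a = ∈⇒∙ˡ-∼ a (⁻¹-closed h∈H)
      t⁻¹∼b : t ⁻¹ ∼ b
      t⁻¹∼b = subst (_∼ b) (solve 2 (λ a h → a ⁻ ⊗ h ⊜ (h ⁻ ⊗ a) ⁻) refl a h) (∼-sym b∼a⁻¹h)

    isPerfectCode-of-oddSquareCondition : OddSquareCondition → IsPerfectCodeOf G H
    isPerfectCode-of-oddSquareCondition condition
      with complete-transversal IsSymmetricTransversal (extend-symmetricTransversal condition)
                                ⁅e⁆-isSymmetricTransversal
    ... | T , symT , covered = isPerfectCode-of-transversal e∈T inverse-closed partial covered
      where open IsSymmetricTransversal symT

  sylow₂-oddSquareCondition : ∀ {H} (sylow : IsSylow G 2 H) → PerfectCodes.OddSquareCondition (proj₁ sylow)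
  sylow₂-oddSquareCondition {H} (H-subgroup , α , ∣H∣≡2^α , _ , 2^1+α∤n)
                            y y²∈H (k , k-odd , |HyH|≡k|H|) =
    decidable-stable (y ∈? H) λ y∉H →
      2^1+α∤n (subst (_∣ n) (|H∪Hy|≡2^1+α y∉H) (Cosets.lagrange H∪Hy? H∪Hy-subgroup))
    where
    open Cosets (_∈? H) (isSubgroupPred H-subgroup)
    |H|≡2^α : count (_∈? H) ≡ 2 ^ α
    |H|≡2^α = trans (sym (∣p∣≡count H)) ∣H∣≡2^α
    H∪Hy? : Decidable ((_∈ H) ∪ (_∼ y))
    H∪Hy? = (_∈? H) ∪? (_∼? y)
    H∪Hy-subgroup : IsSubgroupPred ((_∈ H) ∪ (_∼ y))
    H∪Hy-subgroup = ∪-coset-isSubgroup y²∈H (oddIndex⇒normalises α |H|≡2^α k-odd |HyH|≡k|H|)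
    |H∪Hy|≡2^1+α : y ∉ H → count H∪Hy? ≡ 2 ^ suc α
    |H∪Hy|≡2^1+α y∉H = trans (count-∪-coset y∉H)
      (cong₂ _+_ |H|≡2^α (trans |H|≡2^α (sym (+-identityʳ (2 ^ α)))))

corollary2p4 : (G : FinGroup) (H : Subset (FinGroup.order G)) → IsSylow G 2 H → IsPerfectCodeOf G H
corollary2p4 G H sylow =
  PerfectCodes.isPerfectCode-of-oddSquareCondition (proj₁ sylow) (sylow₂-oddSquareCondition sylow)
  where open FiniteGroup G
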